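{- Let $G=(V,E)$ be a graph and let $R$ be a co-lex relation on $G$. Then the transitive closure $Trans(R)$ of $R$ is a co-lex preorder on $G$.
   Context: $\Sigma$ is a finite alphabet with a fixed total order $\preceq$. A graph is $G=(V,E)$ with $V$ finite and $E\subseteq V\times V\times\Sigma$. Let $\#\notin\Sigma$ with $\#\prec a$ for all $a\in\Sigma$. For $v\in V$, $\lambda(v)$ is the set of labels of edges entering $v$ if $v$ has incoming edges, and $\{\#\}$ otherwise. Write $\lambda(u)\,\angle\,\lambda(v)$ iff $a\preceq b$ for all $a\in\lambda(u)$, $b\in\lambda(v)$. A co-lex relation on $G$ is a reflexive $R\subseteq V\times V$ such that (Axiom 1) $u\neq v$, $(u,v)\in R$ implies $\lambda(u)\,\angle\,\lambda(v)$; (Axiom 2) for $(u',u,a),(v',v,a)\in E$ with $u\neq v$ and $(u,v)\in R$, $(u',v')\in R$. A co-lex preorder is a co-lex relation that is also reflexive and transitive. -}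

module Defs where

open import Level using (0ℓ)
open import Data.Nat using (ℕ)
open import Data.Fin using (Fin)
import Data.Fin as F
open import Data.List using (List)
open import Data.List.Membership.Propositional using (_∈_)
open import Data.Product using (_×_; _,_; ∃-syntax)
open import Relation.Binary.Core using (Rel)
open import Relation.Binary.Definitions using (Reflexive; Transitive)
open import Relation.Binary.PropositionalEquality using (_≡_)
open import Relation.Nullary using (¬_)

-- A graph on vertex set V = Fin n over alphabet Σ = Fin k (totally ordered by
-- the usual order on Fin k).  Edges (u , v , a) : an edge from u to v labelled a.
record Graph (n k : ℕ) : Set where
  field
    edges : List (Fin n × Fin n × Fin k)

open Graph public

data Label (k : ℕ) : Set where
  #   : Label k
  sym : Fin k → Label k

data _≼_ {k : ℕ} : Label k → Label k → Set where
  #≼  : ∀ {l} → # ≼ l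
  sym≼ : ∀ {a b} → a F.≤ b → sym a ≼ sym b

HasIncoming : ∀ {n k} → Graph n k → Fin n → Set
HasIncoming G v = ∃[ u ] ∃[ a ] ((u , v , a) ∈ edges G)

data λ[_] {n k : ℕ} (G : Graph n k) (v : Fin n) : Label k → Set where
  lab  : ∀ {u a} → (u , v , a) ∈ edges G → λ[ G ] v (sym a)
  none : ¬ HasIncoming G v → λ[ G ] v #

_∠[_]_ : ∀ {n k} → Fin n → Graph n k → Fin n → Set
u ∠[ G ] v = ∀ {l l'} → λ[ G ] u l → λ[ G ] v l' → l ≼ l'

Axiom1 : ∀ {n k} → Graph n k → Rel (Fin n) 0ℓ → Set
Axiom1 G R = ∀ {u v} → ¬ (u ≡ v) → R u v → u ∠[ G ] v

Axiom2 : ∀ {n k} → Graph n k → Rel (Fin n) 0ℓ → Set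
Axiom2 G R = ∀ {u' u v' v a} → (u' , u , a) ∈ edges G → (v' , v , a) ∈ edges G →
             ¬ (u ≡ v) → R u v → R u' v'

record IsCoLexRelation {n k} (G : Graph n k) (R : Rel (Fin n) 0ℓ) : Set where
  field
    refl   : Reflexive R
    axiom1 : Axiom1 G R
    axiom2 : Axiom2 G R

record IsCoLexPreorder {n k} (G : Graph n k) (R : Rel (Fin n) 0ℓ) : Set where
  field
    isCoLexRelation : IsCoLexRelation G R
    trans           : Transitive R

{-# OPTIONS --safe #-}
-- Let u ⊑ v mean u = v or λ(u) ∠ λ(v). Since every λ(v) is nonempty, ∠ and hence ⊑ are
-- transitive, and Axiom 1 says R ⊆ ⊑; so Trans(R) ⊆ ⊑, which is Axiom 1 for Trans(R).
-- For Axiom 2, take a chain u = x₀ R x₁ R ⋯ R xₘ = v and a-edges into u and v. Each xᵢ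
-- satisfies u ⊑ xᵢ ⊑ v, and a ∈ λ(u) ∩ λ(v) forces λ(xᵢ) = {a}: every xᵢ has an a-edge
-- entering it. Axiom 2 for R on each step xᵢ ≠ xᵢ₊₁ then chains the a-predecessors.
module Submission where

open import Defs
open import Data.Nat using (ℕ)
open import Data.Fin using (Fin; _≟_)
open import Data.Fin.Properties using (≤-trans; ≤-antisym)
open import Level using (0ℓ)
open import Relation.Binary.Core using (Rel; _⇒_)
open import Relation.Binary.Definitions using (Transitive; Antisymmetric)
open import Relation.Binary.Construct.Closure.Transitive using (TransClosure; [_]; _∷_; _++_)
open import Data.List.Relation.Unary.Any using (any?)
open import Data.List.Membership.Propositional using (_∈_; find; lose)
open import Data.Product using (_,_; ∃; ∃-syntax; proj₁; proj₂)
open import Data.Sum using (_⊎_; inj₁; inj₂)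
open import Data.Empty using (⊥-elim)
open import Relation.Nullary using (Dec; yes; no)
open import Relation.Binary.PropositionalEquality using (_≡_; refl; cong)

module _ {k : ℕ} where

  ≼-trans : Transitive (_≼_ {k})
  ≼-trans #≼         _          = #≼
  ≼-trans (sym≼ a≤b) (sym≼ b≤c) = sym≼ (≤-trans a≤b b≤c)

  ≼-antisym : Antisymmetric _≡_ (_≼_ {k})
  ≼-antisym #≼         #≼         = refl
  ≼-antisym (sym≼ a≤b) (sym≼ b≤a) = cong sym (≤-antisym a≤b b≤a)

module _ {n k : ℕ} (G : Graph n k) where

  hasIncoming? : (v : Fin n) → Dec (HasIncoming G v)
  hasIncoming? v with any? (λ e → proj₁ (proj₂ e) ≟ v) (edges G)
  ... | yes p with find p
  ...   | (u , _ , a) , e∈G , refl = yes (u , a , e∈G)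
  hasIncoming? v | no ¬p = no λ (_ , _ , e∈G) → ¬p (lose e∈G refl)

  λ-nonempty : (v : Fin n) → ∃ (λ[ G ] v)
  λ-nonempty v with hasIncoming? v
  ... | yes (_ , a , e∈G) = sym a , lab e∈G
  ... | no ¬incoming      = # , none ¬incoming

  ∠-trans : Transitive (λ u v → u ∠[ G ] v)
  ∠-trans {j = v} u∠v v∠w lu lw =
    let (_ , lv) = λ-nonempty v in ≼-trans (u∠v lu lv) (v∠w lv lw)

  ∠-squeeze : ∀ {u v w l} → u ∠[ G ] v → v ∠[ G ] w → λ[ G ] u l → λ[ G ] w l → λ[ G ] v l
  ∠-squeeze {v = v} u∠v v∠w lu lw with λ-nonempty v
  ... | _ , lv with ≼-antisym (u∠v lu lv) (v∠w lv lw)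
  ...   | refl = lv

  _⊑_ : Rel (Fin n) 0ℓ
  u ⊑ v = u ≡ v ⊎ u ∠[ G ] v

  ⊑-trans : Transitive _⊑_
  ⊑-trans (inj₁ refl) v⊑w         = v⊑w
  ⊑-trans (inj₂ u∠v)  (inj₁ refl) = inj₂ u∠v
  ⊑-trans (inj₂ u∠v)  (inj₂ v∠w)  = inj₂ (∠-trans u∠v v∠w)

  ⊑-squeeze : ∀ {u v w l} → u ⊑ v → v ⊑ w → λ[ G ] u l → λ[ G ] w l → λ[ G ] v l
  ⊑-squeeze (inj₁ refl) _           lu _  = lu
  ⊑-squeeze (inj₂ _)    (inj₁ refl) _  lw = lw
  ⊑-squeeze (inj₂ u∠v)  (inj₂ v∠w)  lu lw = ∠-squeeze u∠v v∠w lu lw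

  incoming : ∀ {v a} → λ[ G ] v (sym a) → ∃[ v' ] ((v' , v , a) ∈ edges G)
  incoming (lab e∈G) = _ , e∈G

  module _ {R : Rel (Fin n) 0ℓ} (isCoLex : IsCoLexRelation G R) where
    open IsCoLexRelation isCoLex using (axiom1; axiom2)

    R⇒⊑ : R ⇒ _⊑_
    R⇒⊑ {u} {v} uRv with u ≟ v
    ... | yes u≡v = inj₁ u≡v
    ... | no  u≢v = inj₂ (axiom1 u≢v uRv)

    R⁺⇒⊑ : TransClosure R ⇒ _⊑_
    R⁺⇒⊑ [ uRv ]      = R⇒⊑ uRv
    R⁺⇒⊑ (uRv ∷ vR⁺w) = ⊑-trans (R⇒⊑ uRv) (R⁺⇒⊑ vR⁺w)

    axiom1⁺ : Axiom1 G (TransClosure R)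
    axiom1⁺ u≢v uR⁺v with R⁺⇒⊑ uR⁺v
    ... | inj₁ u≡v = ⊥-elim (u≢v u≡v)
    ... | inj₂ u∠v = u∠v

    axiom2⁺ : Axiom2 G (TransClosure R)
    axiom2⁺ eu ev u≢v [ uRv ] = [ axiom2 eu ev u≢v uRv ]
    axiom2⁺ {u = u} {v = v} eu ev u≢v (_∷_ {y = w} uRw wR⁺v) with w ≟ v | u ≟ w
    ... | yes refl | _        = [ axiom2 eu ev u≢v uRw ]
    ... | no  w≢v  | yes refl = axiom2⁺ eu ev w≢v wR⁺v
    ... | no  w≢v  | no  u≢w  =
      let (_ , ew) = incoming (⊑-squeeze (R⇒⊑ uRw) (R⁺⇒⊑ wR⁺v) (lab eu) (lab ev))
      in axiom2 eu ew u≢w uRw ∷ axiom2⁺ ew ev w≢v wR⁺v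

lemma3 : (n k : ℕ) (G : Graph n k) (R : Rel (Fin n) 0ℓ) →
    IsCoLexRelation G R → IsCoLexPreorder G (TransClosure R)
lemma3 n k G R isCoLex = record
  { isCoLexRelation = record
    { refl   = [ IsCoLexRelation.refl isCoLex ]
    ; axiom1 = axiom1⁺ G isCoLex
    ; axiom2 = axiom2⁺ G isCoLex
    }
  ; trans = _++_
  }
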